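{- Let $h_1,\ldots,h_s\in\mathbb{Z}[t]$ be polynomials of degree $d>1$, pairwise relatively prime in $\mathbb{Q}[t]$ and with no integer roots. Then there is a constant $A$, depending only on $h_1,\ldots,h_s$, such that for all positive integers $q$ and $t$, $$\prod_{i=1}^s (h_i(t),q) \le A q.$$
   Context: $(x,y)$ denotes the greatest common divisor. -}

module Defs where

open import Data.Nat as ℕ using (ℕ; zero; suc; _<_; _≤_)
open import Data.Nat.GCD using (gcd)
open import Data.Integer as ℤ using (ℤ; +_; ∣_∣)
open import Data.Rational as ℚ using (ℚ; 0ℚ)
open import Data.Fin using (Fin; zero; suc)
open import Data.List using (List; []; _∷_; map)
open import Relation.Binary.PropositionalEquality using (_≡_)
open import Relation.Nullary using (¬_)
open import Data.Product using (∃)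

-- Polynomials are coefficient lists, constant term first: a₀ ∷ a₁ ∷ … represents a₀ + a₁ t + …
-- (trailing zeros allowed; polynomials are compared coefficientwise).

coeffℤ : List ℤ → ℕ → ℤ
coeffℤ []       _       = + 0
coeffℤ (a ∷ p)  zero    = a
coeffℤ (a ∷ p)  (suc n) = coeffℤ p n

coeffℚ : List ℚ → ℕ → ℚ
coeffℚ []       _       = 0ℚ
coeffℚ (a ∷ p)  zero    = a
coeffℚ (a ∷ p)  (suc n) = coeffℚ p n

eval : List ℤ → ℤ → ℤ
eval []      x = + 0
eval (a ∷ p) x = a ℤ.+ x ℤ.* eval p x

HasDegree : List ℤ → ℕ → Set
HasDegree p d = ¬ (coeffℤ p d ≡ + 0) × (∀ n → d < n → coeffℤ p n ≡ + 0)
  where open import Data.Product using (_×_)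

addℚ : List ℚ → List ℚ → List ℚ
addℚ []      q       = q
addℚ (a ∷ p) []      = a ∷ p
addℚ (a ∷ p) (b ∷ q) = (a ℚ.+ b) ∷ addℚ p q

mulℚ : List ℚ → List ℚ → List ℚ
mulℚ []      q = []
mulℚ (a ∷ p) q = addℚ (map (a ℚ.*_) q) (0ℚ ∷ mulℚ p q)

toℚ[t] : List ℤ → List ℚ
toℚ[t] = map (λ z → z ℚ./ 1)

_∣ℚ[t]_ : List ℚ → List ℚ → Set
g ∣ℚ[t] f = ∃ λ k → ∀ n → coeffℚ (mulℚ g k) n ≡ coeffℚ f n

IsConstant : List ℚ → Set
IsConstant g = ∀ n → 1 ≤ n → coeffℚ g n ≡ 0ℚ

RelPrimeℚ[t] : List ℚ → List ℚ → Set
RelPrimeℚ[t] f g = ∀ c → c ∣ℚ[t] f → c ∣ℚ[t] g → IsConstant c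

prodFin : (s : ℕ) → (Fin s → ℕ) → ℕ
prodFin zero    f = 1
prodFin (suc s) f = f zero ℕ.* prodFin s (λ i → f (suc i))

gcdAt : List ℤ → ℕ → ℕ → ℕ
gcdAt h t q = gcd ∣ eval h (+ t) ∣ q

-- For i ≠ j, clearing denominators in a Bézout identity of ℚ[t] yields a nonzero integer
-- c_ij lying in h_i(t)ℤ + h_j(t)ℤ for every t, so (h_i(t),q) and (h_j(t),q) have a common
-- divisor of c_ij at most. Divisors of q that are pairwise coprime up to the c_ij have a
-- product dividing q ∏_{i<j} c_ij. The integer Bézout identity comes from a fraction-free
-- Euclidean algorithm in ℤ[t]: its last remainder R is an integer combination of h_i and h_j,
-- while nonzero integer multiples of h_i and h_j are ℤ[t]-multiples of R; hence R divides both
-- in ℚ[t], is therefore constant, and is nonzero because h_i is.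

module Submission where

open import Defs
open import Data.Nat using (ℕ; zero; suc)
open import Data.Integer using (ℤ; +_; ∣_∣)
open import Data.Fin using (Fin; zero; suc)
open import Data.List using (List; []; _∷_; map; length)
open import Data.Product using (∃; ∃₂; _×_; _,_; proj₁; proj₂)
open import Data.Sum using (inj₂; [_,_]′)
open import Data.Empty using (⊥-elim)
open import Function using (_∘_; id)
open import Relation.Nullary using (¬_; yes; no)
open import Relation.Binary.PropositionalEquality

module IntegerPolynomials where

  open import Data.Integer using (-_; _+_; _*_; _-_; _^_; _≟_)
  import Data.Integer.Properties as ℤ
  import Data.Integer.Divisibility.Signed as Signed
  open import Data.Integer.Tactic.RingSolver using (solve-∀)
  import Data.Nat as ℕ
  import Data.Nat.Properties as ℕ
  open import Data.Nat.Divisibility using (_∣_)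
  open import Data.Rational as ℚ using (ℚ; 0ℚ; ↥_)
  import Data.Rational.Properties as ℚP
  open import Data.Rational.Literals using (fromℤ)
  open import Data.Vec using (Vec; []; _∷_; _∷ʳ_; _++_; replicate; zipWith)

  private
    variable
      F G H r₀ r₁ r₀′ r₁′ : ℤ → ℤ

  addℤ : List ℤ → List ℤ → List ℤ
  addℤ []      q       = q
  addℤ (a ∷ p) []      = a ∷ p
  addℤ (a ∷ p) (b ∷ q) = (a + b) ∷ addℤ p q

  mulℤ : List ℤ → List ℤ → List ℤ
  mulℤ []      q = []
  mulℤ (a ∷ p) q = addℤ (map (a *_) q) (+ 0 ∷ mulℤ p q)

  monomial : ℤ → ℕ → List ℤ
  monomial a zero    = a ∷ []
  monomial a (suc k) = + 0 ∷ monomial a k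

  eval-addℤ : ∀ p q x → eval (addℤ p q) x ≡ eval p x + eval q x
  eval-addℤ []      q       x = sym (ℤ.+-identityˡ _)
  eval-addℤ (a ∷ p) []      x = sym (ℤ.+-identityʳ _)
  eval-addℤ (a ∷ p) (b ∷ q) x rewrite eval-addℤ p q x = lemma a b x (eval p x) (eval q x)
    where
    lemma : ∀ a b x u v → a + b + x * (u + v) ≡ a + x * u + (b + x * v)
    lemma = solve-∀

  eval-scale : ∀ a p x → eval (map (a *_) p) x ≡ a * eval p x
  eval-scale a []      x = sym (ℤ.*-zeroʳ a)
  eval-scale a (b ∷ p) x rewrite eval-scale a p x = lemma a b x (eval p x)
    where
    lemma : ∀ a b x u → a * b + x * (a * u) ≡ a * (b + x * u)
    lemma = solve-∀

  eval-mulℤ : ∀ p q x → eval (mulℤ p q) x ≡ eval p x * eval q x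
  eval-mulℤ []      q x = refl
  eval-mulℤ (a ∷ p) q x
    rewrite eval-addℤ (map (a *_) q) (+ 0 ∷ mulℤ p q) x | eval-scale a q x | eval-mulℤ p q x
    = lemma a x (eval p x) (eval q x)
    where
    lemma : ∀ a x u v → a * v + (+ 0 + x * (u * v)) ≡ (a + x * u) * v
    lemma = solve-∀

  eval-monomial : ∀ a k x → eval (monomial a k) x ≡ a * x ^ k
  eval-monomial a zero    x = lemma a x
    where
    lemma : ∀ a x → a + x * + 0 ≡ a * + 1
    lemma = solve-∀
  eval-monomial a (suc k) x rewrite eval-monomial a k x = lemma a x (x ^ k)
    where
    lemma : ∀ a x y → + 0 + x * (a * y) ≡ a * (x * y)
    lemma = solve-∀

  coeffℤ-addℤ : ∀ p q n → coeffℤ (addℤ p q) n ≡ coeffℤ p n + coeffℤ q n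
  coeffℤ-addℤ []      q       n       = sym (ℤ.+-identityˡ _)
  coeffℤ-addℤ (a ∷ p) []      zero    = sym (ℤ.+-identityʳ _)
  coeffℤ-addℤ (a ∷ p) []      (suc n) = sym (ℤ.+-identityʳ _)
  coeffℤ-addℤ (a ∷ p) (b ∷ q) zero    = refl
  coeffℤ-addℤ (a ∷ p) (b ∷ q) (suc n) = coeffℤ-addℤ p q n

  coeffℤ-scale : ∀ a p n → coeffℤ (map (a *_) p) n ≡ a * coeffℤ p n
  coeffℤ-scale a []      n       = sym (ℤ.*-zeroʳ a)
  coeffℤ-scale a (b ∷ p) zero    = refl
  coeffℤ-scale a (b ∷ p) (suc n) = coeffℤ-scale a p n

  eval-zero : ∀ p → (∀ n → coeffℤ p n ≡ + 0) → ∀ x → eval p x ≡ + 0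
  eval-zero []      _      x = refl
  eval-zero (a ∷ p) coeff≡0 x rewrite coeff≡0 0 | eval-zero p (coeff≡0 ∘ suc) x =
    trans (ℤ.+-identityˡ _) (ℤ.*-zeroʳ x)

  eval-constant : ∀ p → (∀ n → coeffℤ p (suc n) ≡ + 0) → ∀ x → eval p x ≡ coeffℤ p 0
  eval-constant []      _      x = refl
  eval-constant (a ∷ p) coeff≡0 x rewrite eval-zero p coeff≡0 x | ℤ.*-zeroʳ x = ℤ.+-identityʳ a

  -- Identity theorem

  private
    n≡[1+n]*m⇒m≡0 : ∀ n m → n ≡ suc n ℕ.* m → m ≡ 0
    n≡[1+n]*m⇒m≡0 n zero    _  = refl
    n≡[1+n]*m⇒m≡0 n (suc m) eq =
      ⊥-elim (ℕ.<-irrefl refl (ℕ.≤-trans (ℕ.m≤m*n (suc n) (suc m)) (ℕ.≤-reflexive (sym eq))))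

    ∣a∣≡∣b∣-if-a+b≡0 : ∀ a b → a + b ≡ + 0 → ∣ a ∣ ≡ ∣ b ∣
    ∣a∣≡∣b∣-if-a+b≡0 a b a+b≡0 = begin
      ∣ a ∣           ≡⟨ cong ∣_∣ (lemma a b) ⟩
      ∣ a + b - b ∣   ≡⟨ cong (λ z → ∣ z - b ∣) a+b≡0 ⟩
      ∣ + 0 - b ∣     ≡⟨ trans (cong ∣_∣ (ℤ.+-identityˡ (- b))) (ℤ.∣-i∣≡∣i∣ b) ⟩
      ∣ b ∣           ∎
      where
      open ≡-Reasoning
      lemma : ∀ a b → a ≡ a + b - b
      lemma = solve-∀

  vanishing⇒coeffℤ≡0 : ∀ p → (∀ n → eval p (+ suc n) ≡ + 0) → ∀ k → coeffℤ p k ≡ + 0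
  vanishing⇒coeffℤ≡0 []      _      _       = refl
  vanishing⇒coeffℤ≡0 (a ∷ p) vanish zero    = a≡0
    where
    -- at x = ∣a∣ + 1 the identity a = -x·p(x) is only possible with p(x) = 0
    x : ℤ
    x = + suc ∣ a ∣
    px≡0 : eval p x ≡ + 0
    px≡0 = ℤ.∣i∣≡0⇒i≡0 (n≡[1+n]*m⇒m≡0 ∣ a ∣ ∣ eval p x ∣
      (trans (∣a∣≡∣b∣-if-a+b≡0 a (x * eval p x) (vanish ∣ a ∣)) (ℤ.abs-* x (eval p x))))
    a≡0 : a ≡ + 0
    a≡0 = begin
      a                 ≡⟨ ℤ.+-identityʳ a ⟨
      a + + 0           ≡⟨ cong (λ z → a + z) (ℤ.*-zeroʳ x) ⟨
      a + x * + 0       ≡⟨ cong (λ z → a + x * z) px≡0 ⟨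
      a + x * eval p x  ≡⟨ vanish ∣ a ∣ ⟩
      + 0               ∎
      where open ≡-Reasoning
  vanishing⇒coeffℤ≡0 (a ∷ p) vanish (suc k) = vanishing⇒coeffℤ≡0 p p-vanish k
    where
    a≡0 : a ≡ + 0
    a≡0 = vanishing⇒coeffℤ≡0 (a ∷ p) vanish 0
    p-vanish : ∀ n → eval p (+ suc n) ≡ + 0
    p-vanish n with ℤ.i*j≡0⇒i≡0∨j≡0 (+ suc n)
      (trans (sym (ℤ.+-identityˡ _)) (trans (cong (_+ _) (sym a≡0)) (vanish n)))
    ... | inj₂ px≡0 = px≡0

  coeffℤ-ext : ∀ p q → (∀ n → eval p (+ suc n) ≡ eval q (+ suc n)) → ∀ k → coeffℤ p k ≡ coeffℤ q k
  coeffℤ-ext p q p≡q k = difference≡0⇒≡ (begin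
    coeffℤ p k + - + 1 * coeffℤ q k                     ≡⟨ cong (λ z → coeffℤ p k + z) (coeffℤ-scale (- + 1) q k) ⟨
    coeffℤ p k + coeffℤ (map (- + 1 *_) q) k            ≡⟨ coeffℤ-addℤ p (map (- + 1 *_) q) k ⟨
    coeffℤ (addℤ p (map (- + 1 *_) q)) k                ≡⟨ vanishing⇒coeffℤ≡0 (addℤ p (map (- + 1 *_) q)) difference-vanishes k ⟩
    + 0                                                 ∎)
    where
    open ≡-Reasoning
    difference≡0⇒≡ : ∀ {a b} → a + - + 1 * b ≡ + 0 → a ≡ b
    difference≡0⇒≡ {a} {b} eq = trans (lemma a b) (trans (cong (_+ b) eq) (ℤ.+-identityˡ b))
      where
      lemma : ∀ a b → a ≡ a + - + 1 * b + b
      lemma = solve-∀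
    difference-vanishes : ∀ n → eval (addℤ p (map (- + 1 *_) q)) (+ suc n) ≡ + 0
    difference-vanishes n
      rewrite eval-addℤ p (map (- + 1 *_) q) (+ suc n) | eval-scale (- + 1) q (+ suc n) | p≡q n
      = lemma (eval q (+ suc n))
      where
      lemma : ∀ b → b + - + 1 * b ≡ + 0
      lemma = solve-∀

  -- Passage to ℚ[t]

  toℚ : ℤ → ℚ
  toℚ z = z ℚ./ 1

  private
    toℚ≡fromℤ : ∀ z → toℚ z ≡ fromℤ z
    toℚ≡fromℤ z = ℚP.↥p/↧p≡p (fromℤ z)

  toℚ-injective : ∀ {a b} → toℚ a ≡ toℚ b → a ≡ b
  toℚ-injective {a} {b} eq = cong ↥_ (trans (sym (toℚ≡fromℤ a)) (trans eq (toℚ≡fromℤ b)))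

  toℚ-* : ∀ a b → toℚ (a * b) ≡ toℚ a ℚ.* toℚ b
  toℚ-* a b = sym (cong₂ ℚ._*_ (toℚ≡fromℤ a) (toℚ≡fromℤ b))

  toℚ-+ : ∀ a b → toℚ (a + b) ≡ toℚ a ℚ.+ toℚ b
  toℚ-+ a b = sym (trans (cong₂ ℚ._+_ (toℚ≡fromℤ a) (toℚ≡fromℤ b))
                         (cong (ℚ._/ 1) (cong₂ _+_ (ℤ.*-identityʳ a) (ℤ.*-identityʳ b))))

  toℚ[t]-addℤ : ∀ p q → toℚ[t] (addℤ p q) ≡ addℚ (toℚ[t] p) (toℚ[t] q)
  toℚ[t]-addℤ []      q       = refl
  toℚ[t]-addℤ (a ∷ p) []      = refl
  toℚ[t]-addℤ (a ∷ p) (b ∷ q) = cong₂ _∷_ (toℚ-+ a b) (toℚ[t]-addℤ p q)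

  toℚ[t]-scale : ∀ a q → toℚ[t] (map (a *_) q) ≡ map (toℚ a ℚ.*_) (toℚ[t] q)
  toℚ[t]-scale a []      = refl
  toℚ[t]-scale a (b ∷ q) = cong₂ _∷_ (toℚ-* a b) (toℚ[t]-scale a q)

  toℚ[t]-mulℤ : ∀ p q → toℚ[t] (mulℤ p q) ≡ mulℚ (toℚ[t] p) (toℚ[t] q)
  toℚ[t]-mulℤ []      q = refl
  toℚ[t]-mulℤ (a ∷ p) q = trans (toℚ[t]-addℤ (map (a *_) q) (+ 0 ∷ mulℤ p q))
    (cong₂ addℚ (toℚ[t]-scale a q) (cong (0ℚ ∷_) (toℚ[t]-mulℤ p q)))

  coeffℚ-toℚ[t] : ∀ p n → coeffℚ (toℚ[t] p) n ≡ toℚ (coeffℤ p n)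
  coeffℚ-toℚ[t] []      n       = refl
  coeffℚ-toℚ[t] (a ∷ p) zero    = refl
  coeffℚ-toℚ[t] (a ∷ p) (suc n) = coeffℚ-toℚ[t] p n

  coeffℚ-addℚ : ∀ p q n → coeffℚ (addℚ p q) n ≡ coeffℚ p n ℚ.+ coeffℚ q n
  coeffℚ-addℚ []      q       n       = sym (ℚP.+-identityˡ _)
  coeffℚ-addℚ (a ∷ p) []      zero    = sym (ℚP.+-identityʳ _)
  coeffℚ-addℚ (a ∷ p) []      (suc n) = sym (ℚP.+-identityʳ _)
  coeffℚ-addℚ (a ∷ p) (b ∷ q) zero    = refl
  coeffℚ-addℚ (a ∷ p) (b ∷ q) (suc n) = coeffℚ-addℚ p q n

  coeffℚ-scale : ∀ w q n → coeffℚ (map (w ℚ.*_) q) n ≡ w ℚ.* coeffℚ q n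
  coeffℚ-scale w []      n       = sym (ℚP.*-zeroʳ w)
  coeffℚ-scale w (b ∷ q) zero    = refl
  coeffℚ-scale w (b ∷ q) (suc n) = coeffℚ-scale w q n

  coeffℚ-mulℚ-scaleʳ : ∀ w p q n → coeffℚ (mulℚ p (map (w ℚ.*_) q)) n ≡ w ℚ.* coeffℚ (mulℚ p q) n
  coeffℚ-mulℚ-scaleʳ w []      q n = sym (ℚP.*-zeroʳ w)
  coeffℚ-mulℚ-scaleʳ w (a ∷ p) q n = begin
    coeffℚ (addℚ (map (a ℚ.*_) (map (w ℚ.*_) q)) (0ℚ ∷ mulℚ p (map (w ℚ.*_) q))) n
      ≡⟨ coeffℚ-addℚ (map (a ℚ.*_) (map (w ℚ.*_) q)) (0ℚ ∷ mulℚ p (map (w ℚ.*_) q)) n ⟩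
    coeffℚ (map (a ℚ.*_) (map (w ℚ.*_) q)) n ℚ.+ coeffℚ (0ℚ ∷ mulℚ p (map (w ℚ.*_) q)) n
      ≡⟨ cong₂ ℚ._+_ (trans (coeffℚ-scale a (map (w ℚ.*_) q) n) (cong (a ℚ.*_) (coeffℚ-scale w q n))) (tail n) ⟩
    a ℚ.* (w ℚ.* coeffℚ q n) ℚ.+ w ℚ.* coeffℚ (0ℚ ∷ mulℚ p q) n
      ≡⟨ cong (ℚ._+ _) (trans (sym (ℚP.*-assoc a w _)) (trans (cong (ℚ._* _) (ℚP.*-comm a w)) (ℚP.*-assoc w a _))) ⟩
    w ℚ.* (a ℚ.* coeffℚ q n) ℚ.+ w ℚ.* coeffℚ (0ℚ ∷ mulℚ p q) n
      ≡⟨ ℚP.*-distribˡ-+ w _ _ ⟨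
    w ℚ.* (a ℚ.* coeffℚ q n ℚ.+ coeffℚ (0ℚ ∷ mulℚ p q) n)
      ≡⟨ cong (w ℚ.*_) (trans (coeffℚ-addℚ (map (a ℚ.*_) q) _ n) (cong (ℚ._+ _) (coeffℚ-scale a q n))) ⟨
    w ℚ.* coeffℚ (mulℚ (a ∷ p) q) n
      ∎
    where
    open ≡-Reasoning
    tail : ∀ n → coeffℚ (0ℚ ∷ mulℚ p (map (w ℚ.*_) q)) n ≡ w ℚ.* coeffℚ (0ℚ ∷ mulℚ p q) n
    tail zero    = sym (ℚP.*-zeroʳ w)
    tail (suc n) = coeffℚ-mulℚ-scaleʳ w p q n

  scaled-factorisation⇒∣ℚ[t] : ∀ R u f c → c ≢ + 0 → (∀ n → coeffℤ (mulℤ R u) n ≡ c * coeffℤ f n)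
                             → toℚ[t] R ∣ℚ[t] toℚ[t] f
  scaled-factorisation⇒∣ℚ[t] R u f c c≢0 Ru≡cf = map (w ℚ.*_) (toℚ[t] u) , λ n → begin
    coeffℚ (mulℚ (toℚ[t] R) (map (w ℚ.*_) (toℚ[t] u))) n ≡⟨ coeffℚ-mulℚ-scaleʳ w (toℚ[t] R) (toℚ[t] u) n ⟩
    w ℚ.* coeffℚ (mulℚ (toℚ[t] R) (toℚ[t] u)) n         ≡⟨ cong (λ p → w ℚ.* coeffℚ p n) (toℚ[t]-mulℤ R u) ⟨
    w ℚ.* coeffℚ (toℚ[t] (mulℤ R u)) n                  ≡⟨ cong (w ℚ.*_) (coeffℚ-toℚ[t] (mulℤ R u) n) ⟩
    w ℚ.* toℚ (coeffℤ (mulℤ R u) n)                      ≡⟨ cong (λ z → w ℚ.* toℚ z) (Ru≡cf n) ⟩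
    w ℚ.* toℚ (c * coeffℤ f n)                           ≡⟨ cong (w ℚ.*_) (toℚ-* c (coeffℤ f n)) ⟩
    w ℚ.* (toℚ c ℚ.* toℚ (coeffℤ f n))                   ≡⟨ ℚP.*-assoc w (toℚ c) _ ⟨
    w ℚ.* toℚ c ℚ.* toℚ (coeffℤ f n)                     ≡⟨ cong (ℚ._* _) (ℚP.*-inverseˡ (toℚ c)) ⟩
    ℚ.1ℚ ℚ.* toℚ (coeffℤ f n)                            ≡⟨ ℚP.*-identityˡ _ ⟩
    toℚ (coeffℤ f n)                                     ≡⟨ coeffℚ-toℚ[t] f n ⟨
    coeffℚ (toℚ[t] f) n                                  ∎
    where
    open ≡-Reasoning
    instance
      c≢0ℚ : ℚ.NonZero (toℚ c)
      c≢0ℚ = ℚ.≢-nonZero (c≢0 ∘ toℚ-injective)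
    w : ℚ
    w = ℚ.1/ toℚ c

  IsConstant⇒eval≡coeffℤ₀ : ∀ R → IsConstant (toℚ[t] R) → ∀ x → eval R x ≡ coeffℤ R 0
  IsConstant⇒eval≡coeffℤ₀ R const = eval-constant R λ n →
    toℚ-injective (trans (sym (coeffℚ-toℚ[t] R (suc n))) (const (suc n) (ℕ.s≤s ℕ.z≤n)))

  -- Fraction-free Euclidean algorithm

  -- coefficient vectors listed from the leading coefficient down
  evalᵛ : ∀ {n} → Vec ℤ n → ℤ → ℤ
  evalᵛ []            x = + 0
  evalᵛ {suc n} (a ∷ r) x = a * x ^ n + evalᵛ r x

  evalᵛ-0∷ : ∀ {n} (r : Vec ℤ n) x → evalᵛ (+ 0 ∷ r) x ≡ evalᵛ r x
  evalᵛ-0∷ {n} r x = trans (cong (_+ evalᵛ r x) (ℤ.*-zeroˡ (x ^ n))) (ℤ.+-identityˡ _)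

  evalᵛ-∷ʳ : ∀ {n} (r : Vec ℤ n) a x → evalᵛ (r ∷ʳ a) x ≡ x * evalᵛ r x + a
  evalᵛ-∷ʳ []      a x = lemma a x
    where
    lemma : ∀ a x → a * + 1 + + 0 ≡ x * + 0 + a
    lemma = solve-∀
  evalᵛ-∷ʳ {suc n} (b ∷ r) a x rewrite evalᵛ-∷ʳ r a x = lemma b a x (x ^ n) (evalᵛ r x)
    where
    lemma : ∀ b a x y e → b * (x * y) + (x * e + a) ≡ x * (b * y + e) + a
    lemma = solve-∀

  toVec : (p : List ℤ) → Vec ℤ (length p)
  toVec []      = []
  toVec (a ∷ p) = toVec p ∷ʳ a

  evalᵛ-toVec : ∀ p x → evalᵛ (toVec p) x ≡ eval p x
  evalᵛ-toVec []      x = refl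
  evalᵛ-toVec (a ∷ p) x rewrite evalᵛ-∷ʳ (toVec p) a x | evalᵛ-toVec p x = ℤ.+-comm _ a

  fromVec : ∀ {n} → Vec ℤ n → List ℤ
  fromVec []            = []
  fromVec {suc n} (a ∷ r) = addℤ (monomial a n) (fromVec r)

  eval-fromVec : ∀ {n} (r : Vec ℤ n) x → eval (fromVec r) x ≡ evalᵛ r x
  eval-fromVec []            x = refl
  eval-fromVec {suc n} (a ∷ r) x
    rewrite eval-addℤ (monomial a n) (fromVec r) x | eval-monomial a n x | eval-fromVec r x = refl

  evalᵛ-++-zeros : ∀ {m} (r : Vec ℤ m) k x → evalᵛ (r ++ replicate k (+ 0)) x ≡ x ^ k * evalᵛ r x
  evalᵛ-++-zeros []            k x = trans (zeros k) (sym (ℤ.*-zeroʳ (x ^ k)))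
    where
    zeros : ∀ k → evalᵛ (replicate k (+ 0)) x ≡ + 0
    zeros zero    = refl
    zeros (suc k) = trans (evalᵛ-0∷ (replicate k (+ 0)) x) (zeros k)
  evalᵛ-++-zeros {suc m} (b ∷ r) k x
    rewrite evalᵛ-++-zeros r k x | ℤ.^-distribˡ-+-* x m k = lemma b (x ^ m) (x ^ k) (evalᵛ r x)
    where
    lemma : ∀ b y z e → b * (y * z) + z * e ≡ z * (b * y + e)
    lemma = solve-∀

  evalᵛ-zipWith : ∀ {n} l a (u w : Vec ℤ n) x →
    evalᵛ (zipWith (λ b c → l * b - a * c) u w) x ≡ l * evalᵛ u x - a * evalᵛ w x
  evalᵛ-zipWith l a []      []      x = lemma l a
    where
    lemma : ∀ l a → + 0 ≡ l * + 0 - a * + 0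
    lemma = solve-∀
  evalᵛ-zipWith {suc n} l a (b ∷ u) (c ∷ w) x
    rewrite evalᵛ-zipWith l a u w x = lemma l a b c (x ^ n) (evalᵛ u x) (evalᵛ w x)
    where
    lemma : ∀ l a b c y U W → (l * b - a * c) * y + (l * U - a * W) ≡ l * (b * y + U) - a * (c * y + W)
    lemma = solve-∀

  cancelLeading : ∀ {m k} (a l : ℤ) → Vec ℤ (m ℕ.+ k) → Vec ℤ m → Vec ℤ (m ℕ.+ k)
  cancelLeading {k = k} a l u w = zipWith (λ b c → l * b - a * c) u (w ++ replicate k (+ 0))

  evalᵛ-cancelLeading : ∀ {m k} a l (u : Vec ℤ (m ℕ.+ k)) (w : Vec ℤ m) x →
    evalᵛ (cancelLeading a l u w) x ≡ l * evalᵛ (a ∷ u) x - a * x ^ k * evalᵛ (l ∷ w) x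
  evalᵛ-cancelLeading {m} {k} a l u w x
    rewrite evalᵛ-zipWith l a u (w ++ replicate k (+ 0)) x | evalᵛ-++-zeros w k x | ℤ.^-distribˡ-+-* x m k
    = lemma a l (x ^ m) (x ^ k) (evalᵛ u x) (evalᵛ w x)
    where
    lemma : ∀ a l y z U W → l * U - a * (z * W) ≡ l * (a * (y * z) + U) - a * z * (l * y + W)
    lemma = solve-∀

  InIntSpan : (F G r : ℤ → ℤ) → Set
  InIntSpan F G r = ∀ x → ∃₂ λ α β → r x ≡ α * F x + β * G x

  MultipleInPolySpan : (H r₀ r₁ : ℤ → ℤ) → Set
  MultipleInPolySpan H r₀ r₁ =
    ∃ λ c → c ≢ + 0 × ∃₂ λ u₀ u₁ → ∀ x → c * H x ≡ eval u₀ x * r₀ x + eval u₁ x * r₁ x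

  InIntSpan-step : ∀ l (m : ℤ → ℤ) → InIntSpan F G r₀ → InIntSpan F G r₁
                 → InIntSpan F G (λ x → l * r₀ x - m x * r₁ x)
  InIntSpan-step {F} {G} l m r₀∈ r₁∈ x with r₀∈ x | r₁∈ x
  ... | α₀ , β₀ , e₀ | α₁ , β₁ , e₁ = l * α₀ - m x * α₁ , l * β₀ - m x * β₁ ,
    trans (cong₂ (λ A B → l * A - m x * B) e₀ e₁) (lemma l (m x) α₀ β₀ α₁ β₁ (F x) (G x))
    where
    lemma : ∀ l m α₀ β₀ α₁ β₁ F G → l * (α₀ * F + β₀ * G) - m * (α₁ * F + β₁ * G)
                                 ≡ (l * α₀ - m * α₁) * F + (l * β₀ - m * β₁) * G
    lemma = solve-∀

  MultipleInPolySpan-step : ∀ l p → l ≢ + 0 → MultipleInPolySpan H r₀ r₁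
                          → MultipleInPolySpan H (λ x → l * r₀ x - eval p x * r₁ x) r₁
  MultipleInPolySpan-step {H} {r₀} {r₁} l p l≢0 (c , c≢0 , u₀ , u₁ , e) =
    l * c , lc≢0 , u₀ , addℤ (mulℤ p u₀) (map (l *_) u₁) , λ x → begin
      l * c * H x
        ≡⟨ trans (ℤ.*-assoc l c (H x)) (cong (l *_) (e x)) ⟩
      l * (eval u₀ x * r₀ x + eval u₁ x * r₁ x)
        ≡⟨ lemma l (eval p x) (eval u₀ x) (eval u₁ x) (r₀ x) (r₁ x) ⟩
      eval u₀ x * (l * r₀ x - eval p x * r₁ x) + (eval p x * eval u₀ x + l * eval u₁ x) * r₁ x
        ≡⟨ cong (λ z → eval u₀ x * (l * r₀ x - eval p x * r₁ x) + z * r₁ x) (sym (eval-u₁′ x)) ⟩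
      eval u₀ x * (l * r₀ x - eval p x * r₁ x) + eval (addℤ (mulℤ p u₀) (map (l *_) u₁)) x * r₁ x
        ∎
    where
    open ≡-Reasoning
    lc≢0 : l * c ≢ + 0
    lc≢0 = [ l≢0 , c≢0 ]′ ∘ ℤ.i*j≡0⇒i≡0∨j≡0 l
    lemma : ∀ l P U₀ U₁ R₀ R₁ → l * (U₀ * R₀ + U₁ * R₁) ≡ U₀ * (l * R₀ - P * R₁) + (P * U₀ + l * U₁) * R₁
    lemma = solve-∀
    eval-u₁′ : ∀ x → eval (addℤ (mulℤ p u₀) (map (l *_) u₁)) x ≡ eval p x * eval u₀ x + l * eval u₁ x
    eval-u₁′ x rewrite eval-addℤ (mulℤ p u₀) (map (l *_) u₁) x | eval-mulℤ p u₀ x | eval-scale l u₁ x = refl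

  MultipleInPolySpan-swap : MultipleInPolySpan H r₀ r₁ → MultipleInPolySpan H r₁ r₀
  MultipleInPolySpan-swap {r₀ = r₀} {r₁} (c , c≢0 , u₀ , u₁ , e) =
    c , c≢0 , u₁ , u₀ , λ x → trans (e x) (ℤ.+-comm (eval u₀ x * r₀ x) (eval u₁ x * r₁ x))

  MultipleInPolySpan-cong : r₀ ≗ r₀′ → r₁ ≗ r₁′ → MultipleInPolySpan H r₀ r₁ → MultipleInPolySpan H r₀′ r₁′
  MultipleInPolySpan-cong r₀≗ r₁≗ (c , c≢0 , u₀ , u₁ , e) =
    c , c≢0 , u₀ , u₁ , λ x → trans (e x) (cong₂ (λ A B → eval u₀ x * A + eval u₁ x * B) (r₀≗ x) (r₁≗ x))

  MultipleInPolySpan-root : MultipleInPolySpan H r₀ (λ _ → + 0) → ∀ x → r₀ x ≡ + 0 → H x ≡ + 0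
  MultipleInPolySpan-root {H} {r₀} (c , c≢0 , u₀ , u₁ , e) x r₀x≡0 =
    [ ⊥-elim ∘ c≢0 , id ]′ (ℤ.i*j≡0⇒i≡0∨j≡0 c cHx≡0)
    where
    open ≡-Reasoning
    lemma : ∀ U₀ U₁ → U₀ * + 0 + U₁ * + 0 ≡ + 0
    lemma = solve-∀
    cHx≡0 : c * H x ≡ + 0
    cHx≡0 = begin
      c * H x                              ≡⟨ e x ⟩
      eval u₀ x * r₀ x + eval u₁ x * + 0   ≡⟨ cong (λ z → eval u₀ x * z + eval u₁ x * + 0) r₀x≡0 ⟩
      eval u₀ x * + 0 + eval u₁ x * + 0    ≡⟨ lemma (eval u₀ x) (eval u₁ x) ⟩
      + 0                                  ∎

  MultipleInPolySpan⇒∣ℚ[t] : ∀ R f → MultipleInPolySpan (eval f) (eval R) (λ _ → + 0) → toℚ[t] R ∣ℚ[t] toℚ[t] f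
  MultipleInPolySpan⇒∣ℚ[t] R f (c , c≢0 , u₀ , u₁ , e) = scaled-factorisation⇒∣ℚ[t] R u₀ f c c≢0 λ n →
    trans (coeffℤ-ext (mulℤ R u₀) (map (c *_) f) Ru₀≡cf n) (coeffℤ-scale c f n)
    where
    Ru₀≡cf : ∀ n → eval (mulℤ R u₀) (+ suc n) ≡ eval (map (c *_) f) (+ suc n)
    Ru₀≡cf n = let x = + suc n in begin
      eval (mulℤ R u₀) x                      ≡⟨ eval-mulℤ R u₀ x ⟩
      eval R x * eval u₀ x                    ≡⟨ lemma (eval R x) (eval u₀ x) (eval u₁ x) ⟩
      eval u₀ x * eval R x + eval u₁ x * + 0  ≡⟨ e x ⟨
      c * eval f x                            ≡⟨ eval-scale c f x ⟨
      eval (map (c *_) f) x                   ∎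
      where
      open ≡-Reasoning
      lemma : ∀ R U₀ U₁ → R * U₀ ≡ U₀ * R + U₁ * + 0
      lemma = solve-∀

  record EuclidInvariant (F G r₀ r₁ : ℤ → ℤ) : Set where
    field
      r₀∈span : InIntSpan F G r₀
      r₁∈span : InIntSpan F G r₁
      F∈span  : MultipleInPolySpan F r₀ r₁
      G∈span  : MultipleInPolySpan G r₀ r₁

  EuclidInvariant-refl : EuclidInvariant F G F G
  EuclidInvariant-refl {F} {G} = record
    { r₀∈span = λ x → + 1 , + 0 , lemma₀ (F x) (G x)
    ; r₁∈span = λ x → + 0 , + 1 , lemma₁ (F x) (G x)
    ; F∈span  = + 1 , (λ ()) , + 1 ∷ [] , [] , λ x → lemma₂ x (F x) (G x)
    ; G∈span  = + 1 , (λ ()) , [] , + 1 ∷ [] , λ x → lemma₃ x (F x) (G x)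
    }
    where
    lemma₀ : ∀ F G → F ≡ + 1 * F + + 0 * G
    lemma₀ = solve-∀
    lemma₁ : ∀ F G → G ≡ + 0 * F + + 1 * G
    lemma₁ = solve-∀
    lemma₂ : ∀ x F G → + 1 * F ≡ (+ 1 + x * + 0) * F + + 0 * G
    lemma₂ = solve-∀
    lemma₃ : ∀ x F G → + 1 * G ≡ + 0 * F + (+ 1 + x * + 0) * G
    lemma₃ = solve-∀

  EuclidInvariant-swap : EuclidInvariant F G r₀ r₁ → EuclidInvariant F G r₁ r₀
  EuclidInvariant-swap I = record
    { r₀∈span = r₁∈span ; r₁∈span = r₀∈span
    ; F∈span = MultipleInPolySpan-swap F∈span ; G∈span = MultipleInPolySpan-swap G∈span }
    where open EuclidInvariant I

  EuclidInvariant-cong : r₀ ≗ r₀′ → r₁ ≗ r₁′ → EuclidInvariant F G r₀ r₁ → EuclidInvariant F G r₀′ r₁′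
  EuclidInvariant-cong r₀≗ r₁≗ I = record
    { r₀∈span = λ x → let α , β , e = r₀∈span x in α , β , trans (sym (r₀≗ x)) e
    ; r₁∈span = λ x → let α , β , e = r₁∈span x in α , β , trans (sym (r₁≗ x)) e
    ; F∈span  = MultipleInPolySpan-cong r₀≗ r₁≗ F∈span
    ; G∈span  = MultipleInPolySpan-cong r₀≗ r₁≗ G∈span }
    where open EuclidInvariant I

  EuclidInvariant-step : ∀ l p → l ≢ + 0 → EuclidInvariant F G r₀ r₁
                       → EuclidInvariant F G (λ x → l * r₀ x - eval p x * r₁ x) r₁
  EuclidInvariant-step l p l≢0 I = record
    { r₀∈span = InIntSpan-step l (eval p) r₀∈span r₁∈span
    ; r₁∈span = r₁∈span
    ; F∈span  = MultipleInPolySpan-step l p l≢0 F∈span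
    ; G∈span  = MultipleInPolySpan-step l p l≢0 G∈span }
    where open EuclidInvariant I

  module _ {F G : ℤ → ℤ} where

    private
      Invariantᵛ : ∀ {n₀ n₁} → Vec ℤ n₀ → Vec ℤ n₁ → Set
      Invariantᵛ r₀ r₁ = EuclidInvariant F G (evalᵛ r₀) (evalᵛ r₁)

      Remainder : Set
      Remainder = ∃ λ R → EuclidInvariant F G (eval R) (λ _ → + 0)

    cancelLeading-invariant : ∀ {m n} a l (u : Vec ℤ n) (w : Vec ℤ m) → m ℕ.≤ n → l ≢ + 0
                            → Invariantᵛ (a ∷ u) (l ∷ w) → ∃ λ (r : Vec ℤ n) → Invariantᵛ r (l ∷ w)
    cancelLeading-invariant a l u w m≤n l≢0 I with ℕ.m≤n⇒∃[o]m+o≡n m≤n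
    ... | k , refl = cancelLeading a l u w ,
      EuclidInvariant-cong reduced≗ (λ _ → refl) (EuclidInvariant-step l (monomial a k) l≢0 I)
      where
      reduced≗ : ∀ x → l * evalᵛ (a ∷ u) x - eval (monomial a k) x * evalᵛ (l ∷ w) x
                     ≡ evalᵛ (cancelLeading a l u w) x
      reduced≗ x = trans (cong (λ m → l * evalᵛ (a ∷ u) x - m * evalᵛ (l ∷ w) x) (eval-monomial a k x))
                         (sym (evalᵛ-cancelLeading a l u w x))

    remainder : ∀ {n} (r : Vec ℤ n) → Invariantᵛ r [] → Remainder
    remainder r I = fromVec r , EuclidInvariant-cong (sym ∘ eval-fromVec r) (λ _ → refl) I

    euclid : ∀ n₀ n₁ (r₀ : Vec ℤ n₀) (r₁ : Vec ℤ n₁) → Invariantᵛ r₀ r₁ → Remainder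
    euclid _ zero r₀ [] I = remainder r₀ I
    euclid n₀ (suc n₁) r₀ (l ∷ r₁) I with l ≟ + 0
    ... | yes refl =
      euclid n₀ n₁ r₀ r₁ (EuclidInvariant-cong (λ _ → refl) (evalᵛ-0∷ r₁) I)
    euclid zero (suc n₁) [] (l ∷ r₁) I | no _ =
      remainder (l ∷ r₁) (EuclidInvariant-swap I)
    euclid (suc n₀) (suc n₁) (a ∷ r₀) (l ∷ r₁) I | no l≢0 with a ≟ + 0
    ... | yes refl =
      euclid n₀ (suc n₁) r₀ (l ∷ r₁) (EuclidInvariant-cong (evalᵛ-0∷ r₀) (λ _ → refl) I)
    ... | no a≢0 with n₁ ℕ.≤? n₀
    ...   | yes n₁≤n₀ =
      let r , I′ = cancelLeading-invariant a l r₀ r₁ n₁≤n₀ l≢0 I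
      in euclid n₀ (suc n₁) r (l ∷ r₁) I′
    ...   | no n₁≰n₀ =
      let r , I′ = cancelLeading-invariant l a r₁ r₀ (ℕ.<⇒≤ (ℕ.≰⇒> n₁≰n₀)) a≢0 (EuclidInvariant-swap I)
      in euclid n₁ (suc n₀) r (a ∷ r₀) I′

  euclid-remainder : ∀ f g → ∃ λ R → EuclidInvariant (eval f) (eval g) (eval R) (λ _ → + 0)
  euclid-remainder f g = euclid _ _ (toVec f) (toVec g)
    (EuclidInvariant-cong (sym ∘ evalᵛ-toVec f) (sym ∘ evalᵛ-toVec g) EuclidInvariant-refl)

  bezout-constant : ∀ f g {x₀} → eval f x₀ ≢ + 0 → RelPrimeℚ[t] (toℚ[t] f) (toℚ[t] g)
                  → ∃ λ c → c ≢ + 0 × InIntSpan (eval f) (eval g) (λ _ → c)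
  bezout-constant f g {x₀} fx₀≢0 coprime = coeffℤ R 0 , R₀≢0 , R₀∈span
    where
    R : List ℤ
    R = proj₁ (euclid-remainder f g)
    open EuclidInvariant (proj₂ (euclid-remainder f g))
    R-constant : ∀ x → eval R x ≡ coeffℤ R 0
    R-constant = IsConstant⇒eval≡coeffℤ₀ R (coprime (toℚ[t] R)
      (MultipleInPolySpan⇒∣ℚ[t] R f F∈span) (MultipleInPolySpan⇒∣ℚ[t] R g G∈span))
    R₀≢0 : coeffℤ R 0 ≢ + 0
    R₀≢0 R₀≡0 = fx₀≢0 (MultipleInPolySpan-root F∈span x₀ (trans (R-constant x₀) R₀≡0))
    R₀∈span : InIntSpan (eval f) (eval g) (λ _ → coeffℤ R 0)
    R₀∈span x = let α , β , e = r₀∈span x in α , β , trans (sym (R-constant x)) e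

  InIntSpan⇒∣ : InIntSpan F G r₀ → ∀ x {d} → d ∣ ∣ F x ∣ → d ∣ ∣ G x ∣ → d ∣ ∣ r₀ x ∣
  InIntSpan⇒∣ r₀∈ x {d} d∣F d∣G with r₀∈ x
  ... | α , β , e = Signed.∣⇒∣ᵤ (subst (+ d Signed.∣_) (sym e)
    (Signed.∣m∣n⇒∣m+n (Signed.∣n⇒∣m*n α (Signed.∣ᵤ⇒∣ d∣F)) (Signed.∣n⇒∣m*n β (Signed.∣ᵤ⇒∣ d∣G))))

open IntegerPolynomials using (InIntSpan; bezout-constant; InIntSpan⇒∣)
open import Data.Nat using (_*_; _<_; _≤_; NonZero; ≢-nonZero; >-nonZero)
import Data.Nat.Properties as ℕ
open import Data.Nat.Divisibility
open import Data.Nat.GCD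
open import Data.Nat.LCM using (lcm-least; gcd*lcm)
open import Data.Nat.Tactic.RingSolver using (solve-∀)
import Data.Fin.Properties as Fin
import Data.Integer.Properties as ℤ

-- Products of divisors of q

*-∣-*-gcd : ∀ {a b m} → a ∣ m → b ∣ m → a * b ∣ m * gcd a b
*-∣-*-gcd {a} {b} {m} a∣m b∣m = subst₂ _∣_ (gcd*lcm a b) (ℕ.*-comm (gcd a b) m)
  (*-monoʳ-∣ (gcd a b) (lcm-least a∣m b∣m))

gcd-*-∣ : ∀ a b c → gcd c (a * b) ∣ gcd c a * gcd c b
gcd-*-∣ a b c = subst (d ∣_) eq (gcd-greatest d∣c*G d∣a*G)
  where
  d G : ℕ
  d = gcd c (a * b)
  G = gcd c b
  d∣c : d ∣ c
  d∣c = gcd[m,n]∣m c (a * b)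
  d∣c*G : d ∣ c * G
  d∣c*G = subst (d ∣_) (sym (c*gcd[m,n]≡gcd[cm,cn] c c b)) (gcd-greatest (∣m⇒∣m*n c d∣c) (∣m⇒∣m*n b d∣c))
  d∣a*G : d ∣ a * G
  d∣a*G = subst (d ∣_) (sym (c*gcd[m,n]≡gcd[cm,cn] a c b)) (gcd-greatest (∣n⇒∣m*n a d∣c) (gcd[m,n]∣n c (a * b)))
  eq : gcd (c * G) (a * G) ≡ gcd c a * G
  eq = begin
    gcd (c * G) (a * G) ≡⟨ cong₂ gcd (ℕ.*-comm c G) (ℕ.*-comm a G) ⟩
    gcd (G * c) (G * a) ≡⟨ c*gcd[m,n]≡gcd[cm,cn] G c a ⟨
    G * gcd c a         ≡⟨ ℕ.*-comm G (gcd c a) ⟩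
    gcd c a * G         ∎
    where open ≡-Reasoning

gcd-prodFin-∣ : ∀ s (g K : Fin s → ℕ) a → (∀ j → gcd a (g j) ∣ K j) → gcd a (prodFin s g) ∣ prodFin s K
gcd-prodFin-∣ zero    g K a _     = gcd[m,n]∣n a 1
gcd-prodFin-∣ (suc s) g K a gcd∣K = ∣-trans (gcd-*-∣ (g zero) (prodFin s (g ∘ suc)) a)
  (*-pres-∣ (gcd∣K zero) (gcd-prodFin-∣ s (g ∘ suc) (K ∘ suc) a (gcd∣K ∘ suc)))

prodFin-nonZero : ∀ s (g : Fin s → ℕ) → (∀ i → NonZero (g i)) → NonZero (prodFin s g)
prodFin-nonZero zero    g _  = _
prodFin-nonZero (suc s) g nz = ℕ.m*n≢0 (g zero) _ {{nz zero}} {{prodFin-nonZero s (g ∘ suc) (nz ∘ suc)}}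

PairFamily : ℕ → Set
PairFamily s = (i j : Fin s) → i ≢ j → ℕ

restrictPairs : ∀ {s} → PairFamily (suc s) → PairFamily s
restrictPairs C i j i≢j = C (suc i) (suc j) (i≢j ∘ Fin.suc-injective)

pairProduct : ∀ s → PairFamily s → ℕ
pairProduct zero    C = 1
pairProduct (suc s) C = prodFin s (λ j → C zero (suc j) Fin.0≢1+n) * pairProduct s (restrictPairs C)

pairProduct-nonZero : ∀ s (C : PairFamily s) → (∀ i j i≢j → NonZero (C i j i≢j)) → NonZero (pairProduct s C)
pairProduct-nonZero zero    C _  = _
pairProduct-nonZero (suc s) C nz = ℕ.m*n≢0 _ _
  {{prodFin-nonZero s _ (λ j → nz zero (suc j) Fin.0≢1+n)}}
  {{pairProduct-nonZero s (restrictPairs C) (λ i j i≢j → nz (suc i) (suc j) _)}}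

prodFin-∣-*-pairProduct : ∀ s (g : Fin s → ℕ) q (C : PairFamily s) → (∀ i → g i ∣ q)
                        → (∀ i j i≢j → gcd (g i) (g j) ∣ C i j i≢j) → prodFin s g ∣ q * pairProduct s C
prodFin-∣-*-pairProduct zero    g q C _   _      = 1∣ _
prodFin-∣-*-pairProduct (suc s) g q C g∣q gcd∣C = subst (prodFin (suc s) g ∣_) (rearrange q A K)
  (∣-trans (*-∣-*-gcd (∣m⇒∣m*n A (g∣q zero)) tail∣qA)
           (*-monoʳ-∣ (q * A) (gcd-prodFin-∣ s (g ∘ suc) _ (g zero) (λ j → gcd∣C zero (suc j) Fin.0≢1+n))))
  where
  A K : ℕ
  A = pairProduct s (restrictPairs C)
  K = prodFin s (λ j → C zero (suc j) Fin.0≢1+n)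
  tail∣qA : prodFin s (g ∘ suc) ∣ q * A
  tail∣qA = prodFin-∣-*-pairProduct s (g ∘ suc) q (restrictPairs C) (g∣q ∘ suc)
    (λ i j i≢j → gcd∣C (suc i) (suc j) _)
  rearrange : ∀ q A K → q * A * K ≡ q * (K * A)
  rearrange = solve-∀

lemma2p2 : (s d : ℕ) (h : Fin s → List ℤ) → 1 < d
    → (∀ i → HasDegree (h i) d)
    → (∀ i j → ¬ (i ≡ j) → RelPrimeℚ[t] (toℚ[t] (h i)) (toℚ[t] (h j)))
    → (∀ i (x : ℤ) → ¬ (eval (h i) x ≡ + 0))
    → ∃ λ (A : ℕ) → ∀ (q t : ℕ) → 0 < q → 0 < t
    → prodFin s (λ i → gcdAt (h i) t q) ≤ A * q
lemma2p2 s d h _ _ coprime noRoot = pairProduct s C , bound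
  where
  bezout : ∀ i j → i ≢ j → ∃ λ c → c ≢ + 0 × InIntSpan (eval (h i)) (eval (h j)) (λ _ → c)
  bezout i j i≢j = bezout-constant (h i) (h j) (noRoot i (+ 0)) (coprime i j i≢j)
  C : PairFamily s
  C i j i≢j = ∣ proj₁ (bezout i j i≢j) ∣
  C-nonZero : ∀ i j i≢j → NonZero (C i j i≢j)
  C-nonZero i j i≢j = ≢-nonZero (proj₁ (proj₂ (bezout i j i≢j)) ∘ ℤ.∣i∣≡0⇒i≡0)
  gcd∣C : ∀ q t i j i≢j → gcd (gcdAt (h i) t q) (gcdAt (h j) t q) ∣ C i j i≢j
  gcd∣C q t i j i≢j = InIntSpan⇒∣ (proj₂ (proj₂ (bezout i j i≢j))) (+ t)
    (∣-trans (gcd[m,n]∣m (gcdAt (h i) t q) (gcdAt (h j) t q)) (gcd[m,n]∣m ∣ eval (h i) (+ t) ∣ q))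
    (∣-trans (gcd[m,n]∣n (gcdAt (h i) t q) (gcdAt (h j) t q)) (gcd[m,n]∣m ∣ eval (h j) (+ t) ∣ q))
  bound : ∀ q t → 0 < q → 0 < t → prodFin s (λ i → gcdAt (h i) t q) ≤ pairProduct s C * q
  bound q t 0<q _ = subst (prodFin s (λ i → gcdAt (h i) t q) ≤_) (ℕ.*-comm q (pairProduct s C))
    (∣⇒≤ {{ℕ.m*n≢0 q (pairProduct s C) {{>-nonZero 0<q}} {{pairProduct-nonZero s C C-nonZero}}}}
      (prodFin-∣-*-pairProduct s (λ i → gcdAt (h i) t q) q C (λ i → gcd[m,n]∣n ∣ eval (h i) (+ t) ∣ q)
        (gcd∣C q t)))
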